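{- For all integers $d\ge 1$ and $n\ge 0$, $$|P_n^d|=\sum_{k=0}^{d-1}\binom{d-1}{k}\binom{d+n-k}{d},$$ where $\binom{a}{b}=0$ for integers $0\le a<b$.
   Context: For integers $d\ge 1$ and $n\ge 0$, let $e_1,\dots,e_d$ be the standard unit vectors of $\mathbb{Z}^d$ and let $P_n^d=\{X_1+X_2+\cdots+X_n : X_i\in\{\pm e_1,\dots,\pm e_d\}\text{ for } i=1,\dots,n\}\subseteq\mathbb{Z}^d$ be the set of possible positions of a nearest-neighbour walk in $\mathbb{Z}^d$ starting at the origin after exactly $n$ unit steps (so $P_0^d=\{0\}$). $|P_n^d|$ denotes its cardinality. -}

module Defs where

open import Data.Nat using (ℕ; zero; suc; _+_; _∸_)
open import Data.Nat.Combinatorics using (_C_)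
open import Data.Integer as ℤ using (ℤ; +_; -_)
open import Data.Fin using (Fin)
open import Data.Fin.Properties using () renaming (_≟_ to _≟ᶠ_)
open import Data.Bool using (Bool; true; false)
open import Data.Vec using (Vec; []; _∷_; replicate; zipWith; tabulate)
open import Data.List using (List; map; upTo)
open import Data.Nat.ListAction using (sum)
open import Data.Product using (Σ; ∃; _×_)
open import Data.Irrelevant using (Irrelevant)
open import Relation.Nullary using (yes; no)
open import Relation.Binary.PropositionalEquality using (_≡_)

Point : ℕ → Set
Point d = Vec ℤ d

origin : (d : ℕ) → Point d
origin d = replicate d (+ 0)

_⊕_ : {d : ℕ} → Point d → Point d → Point d
_⊕_ = zipWith ℤ._+_

unit : {d : ℕ} → Fin d → Point d
unit {d} i = tabulate (λ j → if? (i ≟ᶠ j))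
  where
  if? : ∀ {P : Set} → Relation.Nullary.Dec P → ℤ
  if? (yes _) = + 1
  if? (no _)  = + 0

Step : ℕ → Set
Step d = Fin d × Bool

stepVec : {d : ℕ} → Step d → Point d
stepVec (i Data.Product., true)  = unit i
stepVec (i Data.Product., false) = Data.Vec.map -_ (unit i)

endpoint : {d n : ℕ} → Vec (Step d) n → Point d
endpoint {d} []       = origin d
endpoint     (s ∷ ss) = stepVec s ⊕ endpoint ss

InP : (d n : ℕ) → Point d → Set
InP d n x = ∃ λ (w : Vec (Step d) n) → endpoint w ≡ x

-- The set P_n^d as a subtype; membership proof is irrelevant, so
-- elements are determined by the point alone (a genuine subset).
P : (d n : ℕ) → Set
P d n = Σ (Point d) (λ x → Irrelevant (InP d n x))

formula : (d n : ℕ) → ℕ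
formula d n = sum (map (λ k → ((d ∸ 1) C k) * ((d + n ∸ k) C d)) (upTo d))
  where open Data.Nat using (_*_)

{-# OPTIONS --safe #-}
module Submission where

-- A step changes the ℓ¹ norm by exactly one, and for d ≥ 1 a shortest walk to x can be padded by
-- back-and-forth pairs; so P_n^d is the set of x with ∥x∥₁ ≤ n and ∥x∥₁ ≡ n (mod 2). Sorting these
-- points by their first coordinate gives B(d+1, n+1) = B(d+1, n) + B(d, n+1) + B(d, n) for their
-- number B (for d = 0 the last two terms together count a single point, as exactly one of n, n+1
-- is even). The formula obeys the same recurrence and initial values: Pascal's rule applied to each
-- of its two binomial factors expresses both sides through sums Σₖ C(d−1,k) C(m−k,e).

open import Defs
open import Data.Nat
open import Data.Nat.Properties
open import Data.Nat.Combinatorics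
open import Data.Nat.ListAction using (sum)
open import Data.Nat.ListAction.Properties using (sum-++)
open import Data.List using (applyUpTo; _∷ʳ_)
open import Data.List.Properties using (map-upTo; applyUpTo-∷ʳ)
open import Algebra.Properties.CommutativeSemigroup +-commutativeSemigroup using (interchange)
open import Data.Integer as ℤ using (ℤ; +_; -[1+_]; -_; ∣_∣)
import Data.Integer.Properties as ℤ
open import Data.Fin using (Fin; zero; suc)
open import Data.Fin.Properties using (1↔⊤; +↔⊎) renaming (_≟_ to _≟ᶠ_)
open import Data.Bool using (Bool; true; false)
open import Data.Vec as Vec using ([]; _∷_; tabulate)
open import Data.Vec.Properties using (tabulate-cong; tabulate-∘)
open import Data.Product using (Σ-syntax; ∃-syntax; _,_; proj₁; map₂)
open import Data.Sum using (_⊎_; inj₁; inj₂)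
open import Data.Sum.Algebra using (⊎-comm)
open import Data.Sum.Function.Propositional using (_⊎-↔_)
open import Data.Unit using (⊤; tt)
open import Data.Irrelevant as Irrelevant using (Irrelevant; [_])
open import Function using (_∘_)
open import Function.Bundles using (_↔_; mk↔ₛ′)
open import Function.Properties.Inverse using (↔-refl; ↔-sym; ↔-trans)
open import Function.Related.Propositional using (module EquationalReasoning)
open import Relation.Nullary using (Dec; yes; no; does; ¬_; contradiction-irr)
open import Relation.Binary.PropositionalEquality

sum-applyUpTo-cong : ∀ m {f g : ℕ → ℕ} → (∀ {k} → k < m → f k ≡ g k) →
                     sum (applyUpTo f m) ≡ sum (applyUpTo g m)
sum-applyUpTo-cong zero    f≡g = refl
sum-applyUpTo-cong (suc m) f≡g =
  cong₂ _+_ (f≡g z<s) (sum-applyUpTo-cong m (f≡g ∘ s<s))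

sum-applyUpTo-+ : ∀ m (f g : ℕ → ℕ) →
                  sum (applyUpTo (λ k → f k + g k) m) ≡ sum (applyUpTo f m) + sum (applyUpTo g m)
sum-applyUpTo-+ zero    f g = refl
sum-applyUpTo-+ (suc m) f g =
  trans (cong (_+_ (f 0 + g 0)) (sum-applyUpTo-+ m (f ∘ suc) (g ∘ suc)))
        (interchange (f 0) (g 0) (sum (applyUpTo (f ∘ suc) m)) (sum (applyUpTo (g ∘ suc) m)))

sum-applyUpTo-suc : ∀ m (f : ℕ → ℕ) → sum (applyUpTo f (suc m)) ≡ sum (applyUpTo f m) + f m
sum-applyUpTo-suc m f = begin
  sum (applyUpTo f (suc m))       ≡⟨ cong sum (applyUpTo-∷ʳ f m) ⟨
  sum (applyUpTo f m ∷ʳ f m)      ≡⟨ sum-++ (applyUpTo f m) _ ⟩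
  sum (applyUpTo f m) + (f m + 0) ≡⟨ cong (_+_ (sum (applyUpTo f m))) (+-identityʳ (f m)) ⟩
  sum (applyUpTo f m) + f m       ∎
  where open ≡-Reasoning

sum-applyUpTo-zeros : ∀ m {f : ℕ → ℕ} → (∀ k → f k ≡ 0) → sum (applyUpTo f m) ≡ 0
sum-applyUpTo-zeros zero    f≡0 = refl
sum-applyUpTo-zeros (suc m) f≡0 = cong₂ _+_ (f≡0 0) (sum-applyUpTo-zeros m (f≡0 ∘ suc))

binomialSum : ℕ → ℕ → ℕ → ℕ
binomialSum D e m = sum (applyUpTo (λ k → (D C k) * ((m ∸ k) C e)) (suc D))

formula≡binomialSum : ∀ D n → formula (suc D) n ≡ binomialSum D (suc D) (suc D + n)
formula≡binomialSum D n = cong sum (map-upTo (λ k → (D C k) * ((suc D + n ∸ k) C suc D)) (suc D))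

binomialSum-pascalˡ : ∀ D e m → binomialSum (suc D) e (suc m) ≡ binomialSum D e (suc m) + binomialSum D e m
binomialSum-pascalˡ D e m = begin
  binomialSum (suc D) e (suc m)
    ≡⟨ cong (_+_ first) (sum-applyUpTo-cong (suc D) (λ {k} _ → pascal k)) ⟩
  first + sum (applyUpTo (λ k → term k + shifted k) (suc D))
    ≡⟨ cong (_+_ first) (sum-applyUpTo-+ (suc D) term shifted) ⟩
  first + (binomialSum D e m + sum (applyUpTo shifted (suc D)))
    ≡⟨ x+[y+z]≡[x+z]+y first (binomialSum D e m) _ ⟩
  sum (applyUpTo term′ (suc (suc D))) + binomialSum D e m
    ≡⟨ cong (_+ binomialSum D e m) (sum-applyUpTo-suc (suc D) term′) ⟩
  binomialSum D e (suc m) + (D C suc D) * ((suc m ∸ suc D) C e) + binomialSum D e m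
    ≡⟨ cong (λ z → binomialSum D e (suc m) + z * ((m ∸ D) C e) + binomialSum D e m) (k>n⇒nCk≡0 (n<1+n D)) ⟩
  binomialSum D e (suc m) + 0 + binomialSum D e m
    ≡⟨ cong (_+ binomialSum D e m) (+-identityʳ (binomialSum D e (suc m))) ⟩
  binomialSum D e (suc m) + binomialSum D e m ∎
  where
  open ≡-Reasoning
  first : ℕ
  first = 1 * (suc m C e)
  term shifted term′ : ℕ → ℕ
  term k = (D C k) * ((m ∸ k) C e)
  shifted k = (D C suc k) * ((m ∸ k) C e)
  term′ k = (D C k) * ((suc m ∸ k) C e)
  pascal : ∀ k → (suc D C suc k) * ((m ∸ k) C e) ≡ term k + shifted k
  pascal k = trans (cong (_* ((m ∸ k) C e)) (sym (nCk+nC[k+1]≡[n+1]C[k+1] D k)))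
                   (*-distribʳ-+ ((m ∸ k) C e) (D C k) (D C suc k))
  x+[y+z]≡[x+z]+y : ∀ x y z → x + (y + z) ≡ (x + z) + y
  x+[y+z]≡[x+z]+y x y z = trans (cong (_+_ x) (+-comm y z)) (sym (+-assoc x z y))

binomialSum-pascalʳ : ∀ D e m → D ≤ m →
                      binomialSum D (suc e) (suc m) ≡ binomialSum D (suc e) m + binomialSum D e m
binomialSum-pascalʳ D e m D≤m =
  trans (sum-applyUpTo-cong (suc D) (λ k<1+D → pascal (≤-trans (≤-pred k<1+D) D≤m)))
        (sum-applyUpTo-+ (suc D) (λ k → (D C k) * ((m ∸ k) C suc e)) (λ k → (D C k) * ((m ∸ k) C e)))
  where
  pascal : ∀ {k} → k ≤ m →
           (D C k) * ((suc m ∸ k) C suc e) ≡ (D C k) * ((m ∸ k) C suc e) + (D C k) * ((m ∸ k) C e)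
  pascal {k} k≤m = begin
    (D C k) * ((suc m ∸ k) C suc e)                         ≡⟨ cong (λ z → (D C k) * (z C suc e)) (+-∸-assoc 1 k≤m) ⟩
    (D C k) * (suc (m ∸ k) C suc e)                         ≡⟨ cong ((D C k) *_) (nCk+nC[k+1]≡[n+1]C[k+1] (m ∸ k) e) ⟨
    (D C k) * ((m ∸ k) C e + (m ∸ k) C suc e)               ≡⟨ *-distribˡ-+ (D C k) _ _ ⟩
    (D C k) * ((m ∸ k) C e) + (D C k) * ((m ∸ k) C suc e)   ≡⟨ +-comm ((D C k) * ((m ∸ k) C e)) _ ⟩
    (D C k) * ((m ∸ k) C suc e) + (D C k) * ((m ∸ k) C e)   ∎
    where open ≡-Reasoning

formula-zero : ∀ D → formula (suc D) 0 ≡ 1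
formula-zero D = begin
  formula (suc D) 0                          ≡⟨ formula≡binomialSum D 0 ⟩
  binomialSum D (suc D) (suc D + 0)          ≡⟨ cong (binomialSum D (suc D)) (+-identityʳ (suc D)) ⟩
  1 * (suc D C suc D) + sum (applyUpTo vanishing D)
    ≡⟨ cong₂ _+_ (trans (*-identityˡ _) (nCn≡1 (suc D))) (sum-applyUpTo-zeros D vanishing≡0) ⟩
  1                                          ∎
  where
  open ≡-Reasoning
  vanishing : ℕ → ℕ
  vanishing k = (D C suc k) * ((D ∸ k) C suc D)
  vanishing≡0 : ∀ k → vanishing k ≡ 0
  vanishing≡0 k = trans (cong ((D C suc k) *_) (k>n⇒nCk≡0 (s≤s (m∸n≤m D k)))) (*-zeroʳ (D C suc k))

formula-one : ∀ n → formula 1 n ≡ suc n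
formula-one n = trans (+-identityʳ (1 * (suc n C 1))) (trans (*-identityˡ (suc n C 1)) (nC1≡n (suc n)))

formula-one-suc : ∀ n → formula 1 (suc n) ≡ formula 1 n + 1
formula-one-suc n = begin
  formula 1 (suc n)   ≡⟨ formula-one (suc n) ⟩
  suc (suc n)         ≡⟨ +-comm 1 (suc n) ⟩
  suc n + 1           ≡⟨ cong (_+ 1) (formula-one n) ⟨
  formula 1 n + 1     ∎
  where open ≡-Reasoning

formula-suc-suc : ∀ D n →
  formula (suc (suc D)) (suc n) ≡ formula (suc (suc D)) n + (formula (suc D) (suc n) + formula (suc D) n)
formula-suc-suc D n = begin
  formula (suc (suc D)) (suc n)
    ≡⟨ formula≡binomialSum (suc D) (suc n) ⟩
  binomialSum (suc D) e₂ (suc (suc (D + suc n)))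
    ≡⟨ cong (λ m → binomialSum (suc D) e₂ (suc (suc m))) (+-suc D n) ⟩
  binomialSum (suc D) e₂ (3 + q)
    ≡⟨ binomialSum-pascalˡ D e₂ (2 + q) ⟩
  B e₂ (3 + q) + B e₂ (2 + q)
    ≡⟨ cong₂ _+_ (binomialSum-pascalʳ D e₁ (2 + q) (D≤k+q 2)) (binomialSum-pascalʳ D e₁ (1 + q) (D≤k+q 1)) ⟩
  B e₂ (2 + q) + B e₁ (2 + q) + (B e₂ (1 + q) + B e₁ (1 + q))
    ≡⟨ interchange (B e₂ (2 + q)) (B e₁ (2 + q)) (B e₂ (1 + q)) (B e₁ (1 + q)) ⟩
  B e₂ (2 + q) + B e₂ (1 + q) + (B e₁ (2 + q) + B e₁ (1 + q))
    ≡⟨ cong (_+ (B e₁ (2 + q) + B e₁ (1 + q))) (binomialSum-pascalˡ D e₂ (1 + q)) ⟨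
  binomialSum (suc D) e₂ (2 + q) + (B e₁ (2 + q) + B e₁ (1 + q))
    ≡⟨ cong (λ m → binomialSum (suc D) e₂ (2 + q) + (B e₁ (suc m) + B e₁ (1 + q))) (+-suc D n) ⟨
  binomialSum (suc D) e₂ (suc (suc D) + n) + (B e₁ (suc D + suc n) + B e₁ (suc D + n))
    ≡⟨ cong₂ _+_ (formula≡binomialSum (suc D) n) (cong₂ _+_ (formula≡binomialSum D (suc n)) (formula≡binomialSum D n)) ⟨
  formula (suc (suc D)) n + (formula (suc D) (suc n) + formula (suc D) n) ∎
  where
  open ≡-Reasoning
  q e₁ e₂ : ℕ
  q = D + n
  e₁ = suc D
  e₂ = suc (suc D)
  B : ℕ → ℕ → ℕ
  B = binomialSum D
  D≤k+q : ∀ k → D ≤ k + q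
  D≤k+q k = ≤-trans (m≤m+n D n) (m≤n+m q k)

indicator : Bool → ℤ
indicator true  = + 1
indicator false = + 0

dec-indicator : (h : ∀ {P : Set} → Dec P → ℤ) →
                (∀ {P} (p : P) → h (yes p) ≡ + 1) → (∀ {P} (¬p : ¬ P) → h (no ¬p) ≡ + 0) →
                ∀ {P} (x : Dec P) → h x ≡ indicator (does x)
dec-indicator h h-yes h-no (yes p) = h-yes p
dec-indicator h h-yes h-no (no ¬p) = h-no ¬p

-- The coordinates of `unit i` are computed by a helper local to Defs, which cannot be named
-- here; abstracting `i ≡ zero` and its decision lets unification recover it as `_`.
unit≡tabulate : ∀ {d} (i : Fin d) → unit i ≡ tabulate (λ j → indicator (does (i ≟ᶠ j)))
unit≡tabulate {suc d} i with i ≡ zero | i ≟ᶠ zero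
... | _ | i≟0 = let coordinate = dec-indicator _ (λ _ → refl) (λ _ → refl) in
               cong₂ _∷_ (coordinate i≟0) (tabulate-cong (λ j → coordinate (i ≟ᶠ suc j)))

unit-suc : ∀ {d} (i : Fin d) → unit (suc i) ≡ + 0 ∷ unit i
unit-suc i rewrite unit≡tabulate (suc i) | unit≡tabulate i = refl

tabulate-zero : ∀ d → tabulate (λ (_ : Fin d) → + 0) ≡ origin d
tabulate-zero zero    = refl
tabulate-zero (suc d) = cong (+ 0 ∷_) (tabulate-zero d)

sign : Bool → ℤ
sign true  = + 1
sign false = -[1+ 0 ]

stepVec-zero : ∀ {d} b → stepVec {suc d} (zero , b) ≡ sign b ∷ origin d
stepVec-zero {d} true  = cong (+ 1 ∷_) (tabulate-zero d)
stepVec-zero {d} false = cong (-[1+ 0 ] ∷_) (trans (sym (tabulate-∘ -_ (λ _ → + 0))) (tabulate-zero d))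

stepVec-suc : ∀ {d} (i : Fin d) b → stepVec (suc i , b) ≡ + 0 ∷ stepVec (i , b)
stepVec-suc i true  = unit-suc i
stepVec-suc i false = cong (Vec.map -_) (unit-suc i)

origin-⊕ : ∀ {d} (x : Point d) → origin d ⊕ x ≡ x
origin-⊕ []      = refl
origin-⊕ (t ∷ x) = cong₂ _∷_ (ℤ.+-identityˡ t) (origin-⊕ x)

stepVec-zero-⊕ : ∀ {d} b t (x : Point d) → stepVec (zero , b) ⊕ (t ∷ x) ≡ (sign b ℤ.+ t) ∷ x
stepVec-zero-⊕ b t x = trans (cong (_⊕ (t ∷ x)) (stepVec-zero b)) (cong (sign b ℤ.+ t ∷_) (origin-⊕ x))

stepVec-suc-⊕ : ∀ {d} (i : Fin d) b t (x : Point d) → stepVec (suc i , b) ⊕ (t ∷ x) ≡ t ∷ (stepVec (i , b) ⊕ x)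
stepVec-suc-⊕ i b t x = trans (cong (_⊕ (t ∷ x)) (stepVec-suc i b)) (cong (_∷ _) (ℤ.+-identityˡ t))

∥_∥₁ : ∀ {d} → Point d → ℕ
∥ []    ∥₁ = 0
∥ t ∷ x ∥₁ = ∣ t ∣ + ∥ x ∥₁

∥origin∥₁ : ∀ d → ∥ origin d ∥₁ ≡ 0
∥origin∥₁ zero    = refl
∥origin∥₁ (suc d) = ∥origin∥₁ d

Adjacent : ℕ → ℕ → Set
Adjacent m n = m ≡ suc n ⊎ suc m ≡ n

∣sign+∣-adjacent : ∀ b t → Adjacent ∣ sign b ℤ.+ t ∣ ∣ t ∣
∣sign+∣-adjacent true  (+ _)          = inj₁ refl
∣sign+∣-adjacent true  -[1+ zero ]    = inj₂ refl
∣sign+∣-adjacent true  -[1+ suc _ ]   = inj₂ refl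
∣sign+∣-adjacent false (+ zero)       = inj₁ refl
∣sign+∣-adjacent false (+ suc _)      = inj₂ refl
∣sign+∣-adjacent false -[1+ _ ]       = inj₁ refl

∥stepVec⊕∥₁-adjacent : ∀ {d} (s : Step d) (x : Point d) → Adjacent ∥ stepVec s ⊕ x ∥₁ ∥ x ∥₁
∥stepVec⊕∥₁-adjacent (zero , b) (t ∷ x) rewrite stepVec-zero-⊕ b t x with ∣sign+∣-adjacent b t
... | inj₁ e = inj₁ (cong (_+ ∥ x ∥₁) e)
... | inj₂ e = inj₂ (cong (_+ ∥ x ∥₁) e)
∥stepVec⊕∥₁-adjacent (suc i , b) (t ∷ x) rewrite stepVec-suc-⊕ i b t x with ∥stepVec⊕∥₁-adjacent (i , b) x
... | inj₁ e = inj₁ (trans (cong (_+_ ∣ t ∣) e) (+-suc ∣ t ∣ ∥ x ∥₁))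
... | inj₂ e = inj₂ (trans (sym (+-suc ∣ t ∣ _)) (cong (_+_ ∣ t ∣) e))

EvenGap : ℕ → ℕ → Set
EvenGap a n = ∃[ j ] a + (j + j) ≡ n

+-double-suc : ∀ a j → a + (suc j + suc j) ≡ 2 + (a + (j + j))
+-double-suc a j = begin
  a + (suc j + suc j)      ≡⟨ +-suc a (j + suc j) ⟩
  suc (a + (j + suc j))    ≡⟨ cong (λ m → suc (a + m)) (+-suc j j) ⟩
  suc (a + suc (j + j))    ≡⟨ cong suc (+-suc a (j + j)) ⟩
  2 + (a + (j + j))        ∎
  where open ≡-Reasoning

EvenGap-suc : ∀ {a n} → EvenGap a n → EvenGap (suc a) (suc n)
EvenGap-suc = map₂ (cong suc)

EvenGap-pred : ∀ {a n} → EvenGap (suc a) (suc n) → EvenGap a n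
EvenGap-pred = map₂ suc-injective

EvenGap-shrink : ∀ {a n} → EvenGap (suc a) n → EvenGap a (suc n)
EvenGap-shrink {a} (j , e) = suc j , trans (+-double-suc a j) (cong suc e)

EvenGap-2+ : ∀ {a n} → EvenGap a n → EvenGap a (2 + n)
EvenGap-2+ {a} (j , e) = suc j , trans (+-double-suc a j) (cong (_+_ 2) e)

EvenGap-0-2+⁻ : ∀ {n} → EvenGap 0 (2 + n) → EvenGap 0 n
EvenGap-0-2+⁻ (suc j , e) = j , suc-injective (suc-injective (trans (sym (+-double-suc 0 j)) e))

¬EvenGap-0-1 : ¬ EvenGap 0 1
¬EvenGap-0-1 (suc j , e) with trans (sym (+-double-suc 0 j)) e
... | ()

EvenGap-step : ∀ {d n} (s : Step d) {x : Point d} → EvenGap ∥ x ∥₁ n → EvenGap ∥ stepVec s ⊕ x ∥₁ (suc n)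
EvenGap-step s {x} g with ∥stepVec⊕∥₁-adjacent s x
... | inj₁ e = subst (λ a → EvenGap a _) (sym e) (EvenGap-suc {∥ x ∥₁} g)
... | inj₂ e = EvenGap-shrink {∥ stepVec s ⊕ x ∥₁} (subst (λ a → EvenGap a _) (sym e) g)

InP⇒EvenGap : ∀ {d n} {x : Point d} → InP d n x → EvenGap ∥ x ∥₁ n
InP⇒EvenGap {d} ([] , refl)    = 0 , trans (+-identityʳ ∥ origin d ∥₁) (∥origin∥₁ d)
InP⇒EvenGap     (s ∷ w , refl) = EvenGap-step s (InP⇒EvenGap (w , refl))

InP-step : ∀ {d n} {x : Point d} (s : Step d) → InP d n x → InP d (suc n) (stepVec s ⊕ x)
InP-step s (w , refl) = s ∷ w , refl

InP-lift : ∀ {d n} {x : Point d} → InP d n x → InP (suc d) n (+ 0 ∷ x)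
InP-lift ([] , refl)          = [] , refl
InP-lift ((i , b) ∷ w , refl) =
  subst (InP _ _) (stepVec-suc-⊕ i b (+ 0) (endpoint w)) (InP-step (suc i , b) (InP-lift (w , refl)))

InP-head : ∀ {d n} {x : Point d} (t : ℤ) → InP (suc d) n (+ 0 ∷ x) → InP (suc d) (∣ t ∣ + n) (t ∷ x)
InP-head (+ zero) p = p
InP-head {x = x} (+ suc k)      p =
  subst (InP _ _) (stepVec-zero-⊕ true (+ k) x) (InP-step (zero , true) (InP-head (+ k) p))
InP-head {x = x} -[1+ zero ]    p =
  subst (InP _ _) (stepVec-zero-⊕ false (+ 0) x) (InP-step (zero , false) p)
InP-head {x = x} -[1+ suc k ]   p =
  subst (InP _ _) (stepVec-zero-⊕ false -[1+ k ] x) (InP-step (zero , false) (InP-head -[1+ k ] p))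

InP-∥∥₁ : ∀ {d} (x : Point d) → InP d ∥ x ∥₁ x
InP-∥∥₁ []      = [] , refl
InP-∥∥₁ (t ∷ x) = InP-head t (InP-lift (InP-∥∥₁ x))

InP-2+ : ∀ {d n} {x : Point (suc d)} → InP (suc d) n x → InP (suc d) (2 + n) x
InP-2+ {x = t ∷ x} p =
  subst (InP _ _) there-and-back (InP-step (zero , true) (InP-step (zero , false) p))
  where
  there-and-back : stepVec (zero , true) ⊕ (stepVec (zero , false) ⊕ (t ∷ x)) ≡ t ∷ x
  there-and-back = begin
    stepVec (zero , true) ⊕ (stepVec (zero , false) ⊕ (t ∷ x))
      ≡⟨ cong (stepVec (zero , true) ⊕_) (stepVec-zero-⊕ false t x) ⟩
    stepVec (zero , true) ⊕ ((-[1+ 0 ] ℤ.+ t) ∷ x)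
      ≡⟨ stepVec-zero-⊕ true (-[1+ 0 ] ℤ.+ t) x ⟩
    (+ 1 ℤ.+ (-[1+ 0 ] ℤ.+ t)) ∷ x
      ≡⟨ cong (_∷ x) (trans (sym (ℤ.+-assoc (+ 1) -[1+ 0 ] t)) (ℤ.+-identityˡ t)) ⟩
    t ∷ x ∎
    where open ≡-Reasoning

EvenGap⇒InP : ∀ {d n} {x : Point (suc d)} → EvenGap ∥ x ∥₁ n → InP (suc d) n x
EvenGap⇒InP {x = x} (zero , refl)  = subst (λ m → InP _ m x) (sym (+-identityʳ ∥ x ∥₁)) (InP-∥∥₁ x)
EvenGap⇒InP {x = x} (suc j , refl) =
  subst (λ m → InP _ m x) (sym (+-double-suc ∥ x ∥₁ j)) (InP-2+ (EvenGap⇒InP (j , refl)))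

Ball : ℕ → ℕ → Set
Ball d n = Σ[ x ∈ Point d ] Irrelevant (EvenGap ∥ x ∥₁ n)

Ball-≡ : ∀ {d n} {x y : Ball d n} → proj₁ x ≡ proj₁ y → x ≡ y
Ball-≡ {x = _ , _} {y = _ , _} refl = refl

P↔Ball : ∀ d n → P (suc d) n ↔ Ball (suc d) n
P↔Ball d n = mk↔ₛ′ (map₂ (Irrelevant.map InP⇒EvenGap)) (map₂ (Irrelevant.map EvenGap⇒InP))
                   (λ _ → refl) (λ _ → refl)

EvenGap-0⇒origin : ∀ {d} (x : Point d) → Irrelevant (EvenGap ∥ x ∥₁ 0) → x ≡ origin d
EvenGap-0⇒origin []               _     = refl
EvenGap-0⇒origin (+ zero    ∷ x)  g     = cong (+ 0 ∷_) (EvenGap-0⇒origin x g)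
EvenGap-0⇒origin (+ suc _   ∷ _)  [ g ] = contradiction-irr g λ ()
EvenGap-0⇒origin (-[1+ _ ]  ∷ _)  [ g ] = contradiction-irr g λ ()

Ball-radius-zero↔⊤ : ∀ d → Ball d 0 ↔ ⊤
Ball-radius-zero↔⊤ d = mk↔ₛ′ (λ _ → tt) (λ _ → centre) (λ _ → refl)
                             (λ (x , g) → Ball-≡ (sym (EvenGap-0⇒origin x g)))
  where
  centre : Ball d 0
  centre = origin d , [ 0 , trans (+-identityʳ ∥ origin d ∥₁) (∥origin∥₁ d) ]

Ball₀-2+↔ : ∀ n → Ball 0 (2 + n) ↔ Ball 0 n
Ball₀-2+↔ n = mk↔ₛ′ (λ { ([] , g) → [] , Irrelevant.map EvenGap-0-2+⁻ g })
                   (λ { ([] , g) → [] , Irrelevant.map (EvenGap-2+ {0}) g })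
                   (λ { ([] , _) → refl }) (λ { ([] , _) → refl })

Ball₀-consecutive↔⊤ : ∀ n → (Ball 0 (suc n) ⊎ Ball 0 n) ↔ ⊤
Ball₀-consecutive↔⊤ zero = mk↔ₛ′ (λ _ → tt) (λ _ → inj₂ ([] , [ 0 , refl ])) (λ _ → refl) from-to
  where
  from-to : (z : Ball 0 1 ⊎ Ball 0 0) → inj₂ ([] , [ 0 , refl ]) ≡ z
  from-to (inj₁ ([] , [ g ])) = contradiction-irr g ¬EvenGap-0-1
  from-to (inj₂ ([] , _))     = refl
Ball₀-consecutive↔⊤ (suc n) = begin
  (Ball 0 (2 + n) ⊎ Ball 0 (suc n)) ↔⟨ Ball₀-2+↔ n ⊎-↔ ↔-refl ⟩
  (Ball 0 n ⊎ Ball 0 (suc n))       ↔⟨ ⊎-comm _ _ ⟩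
  (Ball 0 (suc n) ⊎ Ball 0 n)       ↔⟨ Ball₀-consecutive↔⊤ n ⟩
  ⊤                                 ∎
  where open EquationalReasoning

-- Moving the first coordinate one step towards 0 would send both +1 and −1 to 0, so points whose
-- first coordinate is 0 or −1 drop that coordinate instead.
module _ {d n : ℕ} where

  shrink : Ball (suc d) (suc n) → Ball (suc d) n ⊎ (Ball d (suc n) ⊎ Ball d n)
  shrink (+ zero ∷ x , g)       = inj₂ (inj₁ (x , g))
  shrink (+ suc k ∷ x , g)      = inj₁ (+ k ∷ x , Irrelevant.map (EvenGap-pred {k + ∥ x ∥₁}) g)
  shrink (-[1+ zero ] ∷ x , g)  = inj₂ (inj₂ (x , Irrelevant.map (EvenGap-pred {∥ x ∥₁}) g))
  shrink (-[1+ suc k ] ∷ x , g) = inj₁ (-[1+ k ] ∷ x , Irrelevant.map (EvenGap-pred {suc k + ∥ x ∥₁}) g)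

  grow : Ball (suc d) n ⊎ (Ball d (suc n) ⊎ Ball d n) → Ball (suc d) (suc n)
  grow (inj₁ (+ k ∷ x , g))      = + suc k ∷ x , Irrelevant.map (EvenGap-suc {k + ∥ x ∥₁}) g
  grow (inj₁ (-[1+ k ] ∷ x , g)) = -[1+ suc k ] ∷ x , Irrelevant.map (EvenGap-suc {suc k + ∥ x ∥₁}) g
  grow (inj₂ (inj₁ (x , g)))     = + 0 ∷ x , g
  grow (inj₂ (inj₂ (x , g)))     = -[1+ 0 ] ∷ x , Irrelevant.map (EvenGap-suc {∥ x ∥₁}) g

  shrink-grow : ∀ z → shrink (grow z) ≡ z
  shrink-grow (inj₁ (+ _ ∷ _ , _))      = refl
  shrink-grow (inj₁ (-[1+ _ ] ∷ _ , _)) = refl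
  shrink-grow (inj₂ (inj₁ _))           = refl
  shrink-grow (inj₂ (inj₂ _))           = refl

  grow-shrink : ∀ z → grow (shrink z) ≡ z
  grow-shrink (+ zero ∷ _ , _)       = refl
  grow-shrink (+ suc _ ∷ _ , _)      = refl
  grow-shrink (-[1+ zero ] ∷ _ , _)  = refl
  grow-shrink (-[1+ suc _ ] ∷ _ , _) = refl

Ball-shift : ∀ d n → Ball (suc d) (suc n) ↔ (Ball (suc d) n ⊎ (Ball d (suc n) ⊎ Ball d n))
Ball-shift d n = mk↔ₛ′ shrink grow shrink-grow grow-shrink

Ball↔Fin : ∀ d n → Ball (suc d) n ↔ Fin (formula (suc d) n)
Ball↔Fin d zero = begin
  Ball (suc d) 0          ↔⟨ Ball-radius-zero↔⊤ (suc d) ⟩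
  ⊤                       ↔⟨ 1↔⊤ ⟨
  Fin 1                   ≡⟨ cong Fin (formula-zero d) ⟨
  Fin (formula (suc d) 0) ∎
  where open EquationalReasoning
Ball↔Fin zero (suc n) = begin
  Ball 1 (suc n)                             ↔⟨ Ball-shift 0 n ⟩
  (Ball 1 n ⊎ (Ball 0 (suc n) ⊎ Ball 0 n))   ↔⟨ Ball↔Fin 0 n ⊎-↔ ↔-trans (Ball₀-consecutive↔⊤ n) (↔-sym 1↔⊤) ⟩
  (Fin (formula 1 n) ⊎ Fin 1)                ↔⟨ +↔⊎ ⟨
  Fin (formula 1 n + 1)                      ≡⟨ cong Fin (formula-one-suc n) ⟨
  Fin (formula 1 (suc n))                    ∎
  where open EquationalReasoning
Ball↔Fin (suc d) (suc n) = begin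
  Ball (2 + d) (suc n)
    ↔⟨ Ball-shift (suc d) n ⟩
  (Ball (2 + d) n ⊎ (Ball (suc d) (suc n) ⊎ Ball (suc d) n))
    ↔⟨ Ball↔Fin (suc d) n ⊎-↔ (Ball↔Fin d (suc n) ⊎-↔ Ball↔Fin d n) ⟩
  (Fin (formula (2 + d) n) ⊎ (Fin (formula (suc d) (suc n)) ⊎ Fin (formula (suc d) n)))
    ↔⟨ ↔-refl ⊎-↔ ↔-sym +↔⊎ ⟩
  (Fin (formula (2 + d) n) ⊎ Fin (formula (suc d) (suc n) + formula (suc d) n))
    ↔⟨ +↔⊎ ⟨
  Fin (formula (2 + d) n + (formula (suc d) (suc n) + formula (suc d) n))
    ≡⟨ cong Fin (formula-suc-suc d n) ⟨
  Fin (formula (2 + d) (suc n))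
    ∎
  where open EquationalReasoning

mainTheorem3 : (d n : ℕ) → d ≥ 1 → P d n ↔ Fin (formula d n)
mainTheorem3 zero    n ()
mainTheorem3 (suc d) n _ = ↔-trans (P↔Ball d n) (Ball↔Fin d n)
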